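{- Let $\sim$ denote either $\cong$ or $\simeq$. For a type expression $A$ the following four conditions are equivalent: (a) $A\in\mathbf{TF}$; (b) $A$ is tail finite; (c) $A\not\sim\top$; (d) $A$ is not a $\top$-variant.
   Context: Pseudo type expressions: $A::=X\mid A\to B\mid\bullet A\mid\mu X.A$ ($\alpha$-equivalent ones identified; $A[B/X]$ capture-avoiding substitution). $\top:=\mu X.\bullet X$; $\bullet^n A$ is $A$ preceded by $n$ bullets. Tail: $t(X)=X$, $t(A\to B)=t(B)$, $t(\bullet A)=\bullet t(A)$, $t(\mu X.A)=\mu X.t(A)$. $A$ is a $\top$-variant iff $t(A)=\bullet^{m_0}\mu X_1.\bullet^{m_1}\cdots\mu X_n.\bullet^{m_n}X_i$ with $1\le i\le n$, $X_i\notin\{X_{i+1},\dots,X_n\}$, $m_i+\dots+m_n\ge1$. Properness in $X$: variable $Y$ iff $Y\ne X$; $\bullet A$ always; $A\to B$ iff both are or $B$ is a $\top$-variant; $\mu Y.A$ ($Y\ne X$) iff $A$ is or $\mu Y.A$ is a $\top$-variant. Type expressions: every $\mu X.A$ has $A$ proper in $X$. $\cong$: smallest relation closed under reflexivity, symmetry, transitivity; $A\cong B\Rightarrow\bullet A\cong\bullet B$; $A\cong C,B\cong D\Rightarrow A\to B\cong C\to D$; $A\to\top\cong\top$; $\mu X.A\cong A[\mu X.A/X]$; if $A\cong C[A/X]$ and $C$ proper in $X$ then $A\cong\mu X.C$. $\simeq$: same rules plus $\bullet(A\to B)\simeq\bullet A\to\bullet B$. A type expression $A$ is tail finite iff $A\cong\bullet^{m_0}(B_1\to\bullet^{m_1}(B_2\to\cdots\to\bullet^{m_{n-1}}(B_n\to\bullet^{m_n}X)\cdots))$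 for some $n\ge0$, $m_0,\dots,m_n\ge0$, type expressions $B_1,\dots,B_n$ and type variable $X$. For a set $V$ of type variables, $\mathbf{TF}^V$ is the smallest set of type expressions containing every type variable $X\notin V$, containing $\bullet A$ whenever $A\in\mathbf{TF}^V$, containing $B\to A$ for every type expression $B$ whenever $A\in\mathbf{TF}^V$, and containing $\mu X.A$ whenever $\mu X.A$ is a type expression and $A\in\mathbf{TF}^{V\cup\{X\}}$. $\mathbf{TF}:=\mathbf{TF}^{\emptyset}$. -}

module Defs where

open import Data.Nat using (ℕ; zero; suc; _≤_)
open import Data.Bool using (Bool; true; false; T)
open import Data.List using (List; []; _∷_; map)
open import Data.List.Relation.Unary.All using (All)
open import Data.Product using (_×_; _,_; proj₂; ∃-syntax)
open import Data.Empty using (⊥)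
open import Relation.Binary.PropositionalEquality using (_≡_; _≢_)
open import Relation.Nullary using (¬_)

-- Pseudo type expressions, with de Bruijn indices (so α-equivalent
-- expressions are literally equal).  `var n` is the variable with index n.
infixr 20 _⇒_
infixr 25 •_
data Ty : Set where
  var  : ℕ → Ty
  _⇒_  : Ty → Ty → Ty
  •_   : Ty → Ty
  μ_   : Ty → Ty

ext : (ℕ → ℕ) → ℕ → ℕ
ext ρ zero    = zero
ext ρ (suc n) = suc (ρ n)

rename : (ℕ → ℕ) → Ty → Ty
rename ρ (var n) = var (ρ n)
rename ρ (A ⇒ B) = rename ρ A ⇒ rename ρ B
rename ρ (• A)   = • rename ρ A
rename ρ (μ A)   = μ rename (ext ρ) A

exts : (ℕ → Ty) → ℕ → Ty
exts σ zero    = var zero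
exts σ (suc n) = rename suc (σ n)

subst : (ℕ → Ty) → Ty → Ty
subst σ (var n) = σ n
subst σ (A ⇒ B) = subst σ A ⇒ subst σ B
subst σ (• A)   = • subst σ A
subst σ (μ A)   = μ subst (exts σ) A

-- A [ B /0] : substitute B for the variable bound by the outermost binder
-- of a body A (index 0), i.e. the A[B/X] of μX.A.
sub0σ : Ty → ℕ → Ty
sub0σ B zero    = B
sub0σ B (suc n) = var n

_[_/0] : Ty → Ty → Ty
A [ B /0] = subst (sub0σ B) A

⊤ᵗ : Ty
⊤ᵗ = μ • var zero

bullets : ℕ → Ty → Ty
bullets zero    A = A
bullets (suc n) A = • bullets n A

tail : Ty → Ty
tail (var n) = var n
tail (A ⇒ B) = tail B
tail (• A)   = • tail A
tail (μ A)   = μ tail A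

-- ⊤-variant shape of a tail: •^{m0} μX1. •^{m1} ⋯ μXn. •^{mn} Xi with Xi
-- bound by the i-th μ (not shadowed) and m_i+⋯+m_n ≥ 1.  The context Γ
-- holds one Bool per enclosing μ (innermost first): "a bullet has occurred
-- since this binder".
lookupB : List Bool → ℕ → Bool
lookupB []      n       = false
lookupB (b ∷ Γ) zero    = b
lookupB (b ∷ Γ) (suc n) = lookupB Γ n

TVShape : List Bool → Ty → Set
TVShape Γ (var n) = T (lookupB Γ n)
TVShape Γ (A ⇒ B) = ⊥
TVShape Γ (• A)   = TVShape (map (λ _ → true) Γ) A
TVShape Γ (μ A)   = TVShape (false ∷ Γ) A

TopVariant : Ty → Set
TopVariant A = TVShape [] (tail A)

data Proper (x : ℕ) : Ty → Set where
  pvar    : ∀ {y} → y ≢ x → Proper x (var y)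
  pbul    : ∀ {A} → Proper x (• A)
  parr    : ∀ {A B} → Proper x A → Proper x B → Proper x (A ⇒ B)
  parrTop : ∀ {A B} → TopVariant B → Proper x (A ⇒ B)
  pmu     : ∀ {A} → Proper (suc x) A → Proper x (μ A)
  pmuTop  : ∀ {A} → TopVariant (μ A) → Proper x (μ A)

data TyExpr : Ty → Set where
  wvar : ∀ {n} → TyExpr (var n)
  warr : ∀ {A B} → TyExpr A → TyExpr B → TyExpr (A ⇒ B)
  wbul : ∀ {A} → TyExpr A → TyExpr (• A)
  wmu  : ∀ {A} → Proper zero A → TyExpr A → TyExpr (μ A)

-- The two equivalences: mode ≅ (cong) and ≃ (simeq, with the extra
-- distribution rule), as relations on type expressions.
data Mode : Set where
  cong simeq : Mode

data Eqv : Mode → Ty → Ty → Set where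
  refl'    : ∀ {m A} → TyExpr A → Eqv m A A
  sym'     : ∀ {m A B} → Eqv m A B → Eqv m B A
  trans'   : ∀ {m A B C} → Eqv m A B → Eqv m B C → Eqv m A C
  bulC     : ∀ {m A B} → Eqv m A B → Eqv m (• A) (• B)
  arrC     : ∀ {m A B C D} → Eqv m A C → Eqv m B D → Eqv m (A ⇒ B) (C ⇒ D)
  arrTop   : ∀ {m A} → TyExpr A → Eqv m (A ⇒ ⊤ᵗ) ⊤ᵗ
  unfold   : ∀ {m A} → TyExpr (μ A) → Eqv m (μ A) (A [ μ A /0])
  contract : ∀ {m A C} → TyExpr (μ C) → Eqv m A (C [ A /0]) → Eqv m A (μ C)
  dist     : ∀ {A B} → TyExpr A → TyExpr B →
             Eqv simeq (• (A ⇒ B)) (• A ⇒ • B)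

_≅_ : Ty → Ty → Set
A ≅ B = Eqv cong A B

tfForm : List (ℕ × Ty) → ℕ → ℕ → Ty
tfForm []             mn x = bullets mn (var x)
tfForm ((m , B) ∷ ps) mn x = bullets m (B ⇒ tfForm ps mn x)

TailFinite : Ty → Set
TailFinite A = ∃[ ps ] ∃[ mn ] ∃[ x ]
  (All (λ p → TyExpr (proj₂ p)) ps × A ≅ tfForm ps mn x)

-- TF^V, where V is the set of variables bound by the k enclosing binders
-- (de Bruijn indices < k); variables X ∉ V are those with index ≥ k.
data TFᵏ : ℕ → Ty → Set where
  tfvar : ∀ {k x} → k ≤ x → TFᵏ k (var x)
  tfbul : ∀ {k A} → TFᵏ k A → TFᵏ k (• A)
  tfarr : ∀ {k A B} → TyExpr B → TFᵏ k A → TFᵏ k (B ⇒ A)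
  tfmu  : ∀ {k A} → TyExpr (μ A) → TFᵏ (suc k) A → TFᵏ k (μ A)

TF : Ty → Set
TF = TFᵏ zero

module Submission where

-- The proof rests on one syntactic invariant, the *tail value* of a type,
-- obtained by reading the tail of A from the inside out: either
-- `fin k x` (the tail ends, under k bullets, in the free variable x),
-- `top` (the tail closes into a loop passing through a bullet, as in ⊤) or
-- `loop` (an unguarded loop μX.X, which no type expression has).
--
--  * The tail value commutes with renaming and substitution, so it is
--    invariant under every rule of ≅ and ≃ (unfolding, contraction, ...).
--  * A is a ⊤-variant iff its tail value is `top`.
--  * The canonical tail finite forms have value `fin`, whereas ⊤ has `top`.
--  * Conversely, a ⊤-variant becomes ≅ ⊤ (hence ≃ ⊤) once ⊤ is substituted
--    for its bound variables, and a type expression whose value is `fin`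
--    lies in TF; every member of TF is tail finite, by unfolding each μ.

open import Defs
open import Data.Bool using (Bool; true; false; T)
open import Data.Empty using (⊥; ⊥-elim)
open import Data.List using (List; []; _∷_; map)
open import Data.List.Relation.Unary.All using ([]; _∷_)
open import Data.Nat using (ℕ; zero; suc; _+_; _≤_; z≤n; s≤s)
open import Data.Nat.Properties using (+-identityʳ; m≢1+n+m; suc-injective)
open import Data.Product using (_×_; _,_; proj₁; proj₂; ∃-syntax)
open import Data.Unit using (⊤; tt)
open import Function.Base using (id; _∘_)
open import Function.Bundles using (_⇔_; mk⇔; Equivalence)
open import Function.Construct.Composition using (_⇔-∘_)
open import Relation.Nullary using (¬_)
open import Relation.Binary.PropositionalEquality
  using (_≡_; _≢_; refl; sym; trans; cong₂)
  renaming (cong to ≡-cong; subst to transport)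

open Equivalence using (to; from)

ext-cong : ∀ {ρ ρ′ : ℕ → ℕ} → (∀ x → ρ x ≡ ρ′ x) → ∀ x → ext ρ x ≡ ext ρ′ x
ext-cong h zero    = refl
ext-cong h (suc x) = ≡-cong suc (h x)

rename-cong : ∀ {ρ ρ′} → (∀ x → ρ x ≡ ρ′ x) → ∀ A → rename ρ A ≡ rename ρ′ A
rename-cong h (var x) = ≡-cong var (h x)
rename-cong h (A ⇒ B) = cong₂ _⇒_ (rename-cong h A) (rename-cong h B)
rename-cong h (• A)   = ≡-cong •_ (rename-cong h A)
rename-cong h (μ A)   = ≡-cong μ_ (rename-cong (ext-cong h) A)

exts-cong : ∀ {σ τ : ℕ → Ty} → (∀ x → σ x ≡ τ x) → ∀ x → exts σ x ≡ exts τ x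
exts-cong h zero    = refl
exts-cong h (suc x) = ≡-cong (rename suc) (h x)

subst-cong : ∀ {σ τ} → (∀ x → σ x ≡ τ x) → ∀ A → subst σ A ≡ subst τ A
subst-cong h (var x) = h x
subst-cong h (A ⇒ B) = cong₂ _⇒_ (subst-cong h A) (subst-cong h B)
subst-cong h (• A)   = ≡-cong •_ (subst-cong h A)
subst-cong h (μ A)   = ≡-cong μ_ (subst-cong (exts-cong h) A)

rename-rename : ∀ ρ ρ′ A → rename ρ (rename ρ′ A) ≡ rename (ρ ∘ ρ′) A
rename-rename ρ ρ′ (var x) = refl
rename-rename ρ ρ′ (A ⇒ B) = cong₂ _⇒_ (rename-rename ρ ρ′ A) (rename-rename ρ ρ′ B)
rename-rename ρ ρ′ (• A)   = ≡-cong •_ (rename-rename ρ ρ′ A)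
rename-rename ρ ρ′ (μ A)   = ≡-cong μ_ (trans (rename-rename (ext ρ) (ext ρ′) A)
  (rename-cong (λ { zero → refl ; (suc x) → refl }) A))

subst-rename : ∀ τ ρ A → subst τ (rename ρ A) ≡ subst (τ ∘ ρ) A
subst-rename τ ρ (var x) = refl
subst-rename τ ρ (A ⇒ B) = cong₂ _⇒_ (subst-rename τ ρ A) (subst-rename τ ρ B)
subst-rename τ ρ (• A)   = ≡-cong •_ (subst-rename τ ρ A)
subst-rename τ ρ (μ A)   = ≡-cong μ_ (trans (subst-rename (exts τ) (ext ρ) A)
  (subst-cong (λ { zero → refl ; (suc x) → refl }) A))

rename-subst : ∀ ρ τ A → rename ρ (subst τ A) ≡ subst (rename ρ ∘ τ) A
rename-subst ρ τ (var x) = refl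
rename-subst ρ τ (A ⇒ B) = cong₂ _⇒_ (rename-subst ρ τ A) (rename-subst ρ τ B)
rename-subst ρ τ (• A)   = ≡-cong •_ (rename-subst ρ τ A)
rename-subst ρ τ (μ A)   = ≡-cong μ_ (trans (rename-subst (ext ρ) (exts τ) A)
  (subst-cong (λ { zero → refl
                 ; (suc x) → trans (rename-rename (ext ρ) suc (τ x))
                                   (sym (rename-rename suc ρ (τ x))) }) A))

subst-subst : ∀ τ σ A → subst τ (subst σ A) ≡ subst (subst τ ∘ σ) A
subst-subst τ σ (var x) = refl
subst-subst τ σ (A ⇒ B) = cong₂ _⇒_ (subst-subst τ σ A) (subst-subst τ σ B)
subst-subst τ σ (• A)   = ≡-cong •_ (subst-subst τ σ A)
subst-subst τ σ (μ A)   = ≡-cong μ_ (trans (subst-subst (exts τ) (exts σ) A)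
  (subst-cong (λ { zero → refl
                 ; (suc x) → trans (subst-rename (exts τ) suc (σ x))
                                   (sym (rename-subst suc τ (σ x))) }) A))

subst-id : ∀ A → subst var A ≡ A
subst-id (var x) = refl
subst-id (A ⇒ B) = cong₂ _⇒_ (subst-id A) (subst-id B)
subst-id (• A)   = ≡-cong •_ (subst-id A)
subst-id (μ A)   = ≡-cong μ_ (trans (subst-cong (λ { zero → refl ; (suc x) → refl }) A)
                                    (subst-id A))

_∷ₛ_ : Ty → (ℕ → Ty) → ℕ → Ty
(B ∷ₛ σ) zero    = B
(B ∷ₛ σ) (suc x) = σ x

exts-[/0] : ∀ B σ A → subst (exts σ) A [ B /0] ≡ subst (B ∷ₛ σ) A
exts-[/0] B σ A = trans (subst-subst (sub0σ B) (exts σ) A)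
  (subst-cong (λ { zero → refl
                 ; (suc x) → trans (subst-rename (sub0σ B) suc (σ x)) (subst-id (σ x)) }) A)

-- Tail values

-- `fin k x`: k bullets, then the free variable x; `top`: a loop through a
-- bullet; `loop`: a loop through no bullet.
data TailVal : Set where
  fin  : ℕ → ℕ → TailVal
  top  : TailVal
  loop : TailVal

•ᵛ_ : TailVal → TailVal
•ᵛ fin k x = fin (suc k) x
•ᵛ top     = top
•ᵛ loop    = loop

bulletsᵛ : ℕ → TailVal → TailVal
bulletsᵛ zero    v = v
bulletsᵛ (suc k) v = •ᵛ bulletsᵛ k v

-- Closing the binder with index 0: a variable pointing to it closes a loop,
-- guarded iff at least one bullet lies between.
μᵛ_ : TailVal → TailVal
μᵛ fin k (suc x)    = fin k x
μᵛ fin zero zero    = loop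
μᵛ fin (suc k) zero = top
μᵛ top              = top
μᵛ loop             = loop

tailVal : Ty → TailVal
tailVal (var x) = fin 0 x
tailVal (A ⇒ B) = tailVal B
tailVal (• A)   = •ᵛ tailVal A
tailVal (μ A)   = μᵛ tailVal A

renameᵛ : (ℕ → ℕ) → TailVal → TailVal
renameᵛ ρ (fin k x) = fin k (ρ x)
renameᵛ ρ top       = top
renameᵛ ρ loop      = loop

substᵛ : (ℕ → Ty) → TailVal → TailVal
substᵛ σ (fin k x) = bulletsᵛ k (tailVal (σ x))
substᵛ σ top       = top
substᵛ σ loop      = loop

bulletsᵛ-fin : ∀ k j x → bulletsᵛ k (fin j x) ≡ fin (k + j) x
bulletsᵛ-fin zero    j x = refl
bulletsᵛ-fin (suc k) j x = ≡-cong •ᵛ_ (bulletsᵛ-fin k j x)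

bulletsᵛ-var : ∀ k x → bulletsᵛ k (fin 0 x) ≡ fin k x
bulletsᵛ-var k x = trans (bulletsᵛ-fin k 0 x) (≡-cong (λ n → fin n x) (+-identityʳ k))

bulletsᵛ-top : ∀ k → bulletsᵛ k top ≡ top
bulletsᵛ-top zero    = refl
bulletsᵛ-top (suc k) = ≡-cong •ᵛ_ (bulletsᵛ-top k)

bulletsᵛ-loop : ∀ k → bulletsᵛ k loop ≡ loop
bulletsᵛ-loop zero    = refl
bulletsᵛ-loop (suc k) = ≡-cong •ᵛ_ (bulletsᵛ-loop k)

tailVal-bullets : ∀ k A → tailVal (bullets k A) ≡ bulletsᵛ k (tailVal A)
tailVal-bullets zero    A = refl
tailVal-bullets (suc k) A = ≡-cong •ᵛ_ (tailVal-bullets k A)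

•ᵛ-renameᵛ : ∀ ρ v → •ᵛ renameᵛ ρ v ≡ renameᵛ ρ (•ᵛ v)
•ᵛ-renameᵛ ρ (fin k x) = refl
•ᵛ-renameᵛ ρ top       = refl
•ᵛ-renameᵛ ρ loop      = refl

μᵛ-renameᵛ : ∀ ρ v → μᵛ renameᵛ (ext ρ) v ≡ renameᵛ ρ (μᵛ v)
μᵛ-renameᵛ ρ (fin k (suc x))    = refl
μᵛ-renameᵛ ρ (fin zero zero)    = refl
μᵛ-renameᵛ ρ (fin (suc k) zero) = refl
μᵛ-renameᵛ ρ top                = refl
μᵛ-renameᵛ ρ loop               = refl

tailVal-rename : ∀ ρ A → tailVal (rename ρ A) ≡ renameᵛ ρ (tailVal A)
tailVal-rename ρ (var x) = refl
tailVal-rename ρ (A ⇒ B) = tailVal-rename ρ B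
tailVal-rename ρ (• A)   =
  trans (≡-cong •ᵛ_ (tailVal-rename ρ A)) (•ᵛ-renameᵛ ρ (tailVal A))
tailVal-rename ρ (μ A)   =
  trans (≡-cong μᵛ_ (tailVal-rename (ext ρ) A)) (μᵛ-renameᵛ ρ (tailVal A))

•ᵛ-substᵛ : ∀ σ v → •ᵛ substᵛ σ v ≡ substᵛ σ (•ᵛ v)
•ᵛ-substᵛ σ (fin k x) = refl
•ᵛ-substᵛ σ top       = refl
•ᵛ-substᵛ σ loop      = refl

μᵛ-bulletsᵛ-weaken : ∀ k w → μᵛ bulletsᵛ k (renameᵛ suc w) ≡ bulletsᵛ k w
μᵛ-bulletsᵛ-weaken k (fin j y) =
  trans (≡-cong μᵛ_ (bulletsᵛ-fin k j (suc y))) (sym (bulletsᵛ-fin k j y))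
μᵛ-bulletsᵛ-weaken k top  = trans (≡-cong μᵛ_ (bulletsᵛ-top k)) (sym (bulletsᵛ-top k))
μᵛ-bulletsᵛ-weaken k loop = trans (≡-cong μᵛ_ (bulletsᵛ-loop k)) (sym (bulletsᵛ-loop k))

μᵛ-substᵛ : ∀ σ v → μᵛ substᵛ (exts σ) v ≡ substᵛ σ (μᵛ v)
μᵛ-substᵛ σ (fin k (suc x))    =
  trans (≡-cong (μᵛ_ ∘ bulletsᵛ k) (tailVal-rename suc (σ x)))
        (μᵛ-bulletsᵛ-weaken k (tailVal (σ x)))
μᵛ-substᵛ σ (fin zero zero)    = refl
μᵛ-substᵛ σ (fin (suc k) zero) = ≡-cong (μᵛ_ ∘ •ᵛ_) (bulletsᵛ-fin k 0 0)
μᵛ-substᵛ σ top                = refl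
μᵛ-substᵛ σ loop               = refl

tailVal-subst : ∀ σ A → tailVal (subst σ A) ≡ substᵛ σ (tailVal A)
tailVal-subst σ (var x) = refl
tailVal-subst σ (A ⇒ B) = tailVal-subst σ B
tailVal-subst σ (• A)   =
  trans (≡-cong •ᵛ_ (tailVal-subst σ A)) (•ᵛ-substᵛ σ (tailVal A))
tailVal-subst σ (μ A)   =
  trans (≡-cong μᵛ_ (tailVal-subst (exts σ) A)) (μᵛ-substᵛ σ (tailVal A))

-- ⊤-variants are exactly the types with tail value `top`

-- Record that a bullet has occurred below every enclosing binder.
guard : List Bool → List Bool
guard = map (λ _ → true)

lookup-guard : ∀ Γ x → T (lookupB Γ x) → T (lookupB (guard Γ) x)
lookup-guard (b ∷ Γ) zero    h = tt
lookup-guard (b ∷ Γ) (suc x) h = lookup-guard Γ x h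

lookup-guard-idem : ∀ Γ x → lookupB (guard (guard Γ)) x ≡ lookupB (guard Γ) x
lookup-guard-idem []      x       = refl
lookup-guard-idem (b ∷ Γ) zero    = refl
lookup-guard-idem (b ∷ Γ) (suc x) = lookup-guard-idem Γ x

-- What `TVShape Γ` asserts of a tail, read off from its tail value.
TopShape : List Bool → TailVal → Set
TopShape Γ (fin zero x)    = T (lookupB Γ x)
TopShape Γ (fin (suc k) x) = T (lookupB (guard Γ) x)
TopShape Γ top             = ⊤
TopShape Γ loop            = ⊥

TopShape-• : ∀ Γ v → TopShape (guard Γ) v ⇔ TopShape Γ (•ᵛ v)
TopShape-• Γ (fin zero x)    = mk⇔ id id
TopShape-• Γ (fin (suc k) x) = mk⇔ (transport T (lookup-guard-idem Γ x))
                                   (transport T (sym (lookup-guard-idem Γ x)))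
TopShape-• Γ top             = mk⇔ id id
TopShape-• Γ loop            = mk⇔ id id

TopShape-μ : ∀ Γ v → TopShape (false ∷ Γ) v ⇔ TopShape Γ (μᵛ v)
TopShape-μ Γ (fin zero (suc x))    = mk⇔ id id
TopShape-μ Γ (fin (suc k) (suc x)) = mk⇔ id id
TopShape-μ Γ (fin zero zero)       = mk⇔ id id
TopShape-μ Γ (fin (suc k) zero)    = mk⇔ id id
TopShape-μ Γ top                   = mk⇔ id id
TopShape-μ Γ loop                  = mk⇔ id id

TVShape⇔TopShape : ∀ Γ A → TVShape Γ (tail A) ⇔ TopShape Γ (tailVal A)
TVShape⇔TopShape Γ (var x) = mk⇔ id id
TVShape⇔TopShape Γ (A ⇒ B) = TVShape⇔TopShape Γ B
TVShape⇔TopShape Γ (• A)   = TopShape-• Γ (tailVal A) ⇔-∘ TVShape⇔TopShape (guard Γ) A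
TVShape⇔TopShape Γ (μ A)   = TopShape-μ Γ (tailVal A) ⇔-∘ TVShape⇔TopShape (false ∷ Γ) A

TopShape[]⇔top : ∀ v → TopShape [] v ⇔ (v ≡ top)
TopShape[]⇔top v = mk⇔ (to-top v) (λ { refl → tt })
  where
    to-top : ∀ v → TopShape [] v → v ≡ top
    to-top (fin zero x)    ()
    to-top (fin (suc k) x) ()
    to-top top             tt = refl

topVariant⇔top : ∀ A → TopVariant A ⇔ (tailVal A ≡ top)
topVariant⇔top A = TopShape[]⇔top (tailVal A) ⇔-∘ TVShape⇔TopShape [] A

μᵛ-fin : ∀ v j x → μᵛ v ≡ fin j x → v ≡ fin j (suc x)
μᵛ-fin (fin k (suc y))    .k .y refl = refl
μᵛ-fin (fin zero zero)    _  _  ()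
μᵛ-fin (fin (suc k) zero) _  _  ()

top≢fin : ∀ {j x} → top ≢ fin j x
top≢fin ()

•ᵛ≢fin0 : ∀ v {x} → •ᵛ v ≢ fin 0 x
•ᵛ≢fin0 (fin k y) ()
•ᵛ≢fin0 top       ()
•ᵛ≢fin0 loop      ()

tailVal-proper : ∀ {x A} → Proper x A → tailVal A ≢ fin 0 x
tailVal-proper (pvar y≢x) refl = y≢x refl
tailVal-proper {A = • A} pbul eq = •ᵛ≢fin0 (tailVal A) eq
tailVal-proper (parr p q) eq = tailVal-proper q eq
tailVal-proper (parrTop {B = B} tv) eq = top≢fin (trans (sym (to (topVariant⇔top B) tv)) eq)
tailVal-proper {x} {μ A} (pmu p) eq = tailVal-proper p (μᵛ-fin (tailVal A) 0 x eq)
tailVal-proper {A = A} (pmuTop tv) eq = top≢fin (trans (sym (to (topVariant⇔top A) tv)) eq)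

-- No type expression contains an unguarded loop in its tail.  (Only the
-- listed values of the body can produce `loop` under •ᵛ and μᵛ.)
tailVal-tyExpr : ∀ {A} → TyExpr A → tailVal A ≢ loop
tailVal-tyExpr (warr a b) eq = tailVal-tyExpr b eq
tailVal-tyExpr {• A} (wbul a) eq with tailVal A in eqA
... | loop = tailVal-tyExpr a eqA
tailVal-tyExpr {μ A} (wmu p a) eq with tailVal A in eqA
... | fin zero zero = tailVal-proper p eqA
... | loop          = tailVal-tyExpr a eqA

-- Renaming and substitution map `top` to `top`, so preserve ⊤-variants.
topVariant-rename : ∀ ρ A → TopVariant A → TopVariant (rename ρ A)
topVariant-rename ρ A tv = from (topVariant⇔top (rename ρ A))
  (trans (tailVal-rename ρ A) (≡-cong (renameᵛ ρ) (to (topVariant⇔top A) tv)))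

topVariant-subst : ∀ σ A → TopVariant A → TopVariant (subst σ A)
topVariant-subst σ A tv = from (topVariant⇔top (subst σ A))
  (trans (tailVal-subst σ A) (≡-cong (substᵛ σ) (to (topVariant⇔top A) tv)))

proper-rename-fresh : ∀ {x} ρ → (∀ y → ρ y ≢ x) → ∀ A → Proper x (rename ρ A)
proper-rename-fresh ρ avoid (var y) = pvar (avoid y)
proper-rename-fresh ρ avoid (A ⇒ B) =
  parr (proper-rename-fresh ρ avoid A) (proper-rename-fresh ρ avoid B)
proper-rename-fresh ρ avoid (• A)   = pbul
proper-rename-fresh ρ avoid (μ A)   = pmu (proper-rename-fresh (ext ρ) avoid′ A)
  where
    avoid′ : ∀ y → ext ρ y ≢ suc _
    avoid′ zero    ()
    avoid′ (suc y) eq = avoid y (suc-injective eq)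

proper-rename : ∀ {x A} ρ → (∀ y → ρ y ≡ ρ x → y ≡ x) →
                Proper x A → Proper (ρ x) (rename ρ A)
proper-rename ρ inj (pvar y≢x)           = pvar (y≢x ∘ inj _)
proper-rename ρ inj pbul                 = pbul
proper-rename ρ inj (parr p q)           = parr (proper-rename ρ inj p) (proper-rename ρ inj q)
proper-rename ρ inj (parrTop {B = B} tv) = parrTop (topVariant-rename ρ B tv)
proper-rename {x} ρ inj (pmu p)          = pmu (proper-rename (ext ρ) inj′ p)
  where
    inj′ : ∀ y → ext ρ y ≡ ext ρ (suc x) → y ≡ suc x
    inj′ zero    ()
    inj′ (suc y) eq = ≡-cong suc (inj y (suc-injective eq))
proper-rename ρ inj (pmuTop {A = A} tv)  = pmuTop (topVariant-rename ρ (μ A) tv)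

tyExpr-rename : ∀ ρ {A} → TyExpr A → TyExpr (rename ρ A)
tyExpr-rename ρ wvar       = wvar
tyExpr-rename ρ (warr a b) = warr (tyExpr-rename ρ a) (tyExpr-rename ρ b)
tyExpr-rename ρ (wbul a)   = wbul (tyExpr-rename ρ a)
tyExpr-rename ρ (wmu p a)  = wmu (proper-rename (ext ρ) inj p) (tyExpr-rename (ext ρ) a)
  where
    inj : ∀ y → ext ρ y ≡ 0 → y ≡ 0
    inj zero    _  = refl
    inj (suc y) ()

proper-subst : ∀ {x x′ A} σ → σ x ≡ var x′ → (∀ y → y ≢ x → Proper x′ (σ y)) →
               Proper x A → Proper x′ (subst σ A)
proper-subst σ σx others (pvar y≢x) = others _ y≢x
proper-subst σ σx others pbul = pbul
proper-subst σ σx others (parr p q) =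
  parr (proper-subst σ σx others p) (proper-subst σ σx others q)
proper-subst σ σx others (parrTop {B = B} tv) = parrTop (topVariant-subst σ B tv)
proper-subst {x} {x′} σ σx others (pmu p) =
  pmu (proper-subst (exts σ) (≡-cong (rename suc) σx) others′ p)
  where
    others′ : ∀ y → y ≢ suc x → Proper (suc x′) (exts σ y)
    others′ zero    _   = pvar (λ ())
    others′ (suc y) y≢x =
      proper-rename suc (λ _ → suc-injective) (others y (y≢x ∘ ≡-cong suc))
proper-subst σ σx others (pmuTop {A = A} tv) = pmuTop (topVariant-subst σ (μ A) tv)

tyExpr-subst : ∀ σ → (∀ x → TyExpr (σ x)) → ∀ {A} → TyExpr A → TyExpr (subst σ A)
tyExpr-subst σ tyσ (wvar {x}) = tyσ x
tyExpr-subst σ tyσ (warr a b) = warr (tyExpr-subst σ tyσ a) (tyExpr-subst σ tyσ b)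
tyExpr-subst σ tyσ (wbul a)   = wbul (tyExpr-subst σ tyσ a)
tyExpr-subst σ tyσ (wmu p a)  =
  wmu (proper-subst (exts σ) refl others p) (tyExpr-subst (exts σ) tyExts a)
  where
    others : ∀ y → y ≢ 0 → Proper 0 (exts σ y)
    others zero    0≢0 = ⊥-elim (0≢0 refl)
    others (suc y) _   = proper-rename-fresh suc (λ _ ()) (σ y)
    tyExts : ∀ x → TyExpr (exts σ x)
    tyExts zero    = wvar
    tyExts (suc x) = tyExpr-rename suc (tyσ x)

tyExpr-∷ₛ : ∀ {B σ} → TyExpr B → (∀ x → TyExpr (σ x)) → ∀ x → TyExpr ((B ∷ₛ σ) x)
tyExpr-∷ₛ b tyσ zero    = b
tyExpr-∷ₛ b tyσ (suc x) = tyσ x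

tyExpr-⊤ : TyExpr ⊤ᵗ
tyExpr-⊤ = wmu pbul (wbul wvar)

tyExpr-unfold : ∀ {A} → TyExpr (μ A) → TyExpr (A [ μ A /0])
tyExpr-unfold μA@(wmu p a) = tyExpr-subst _ (λ { zero → μA ; (suc x) → wvar }) a

eqv-tyExpr : ∀ {m A B} → Eqv m A B → TyExpr A × TyExpr B
eqv-tyExpr (refl' a)      = a , a
eqv-tyExpr (sym' e)       = proj₂ (eqv-tyExpr e) , proj₁ (eqv-tyExpr e)
eqv-tyExpr (trans' e f)   = proj₁ (eqv-tyExpr e) , proj₂ (eqv-tyExpr f)
eqv-tyExpr (bulC e)       = wbul (proj₁ (eqv-tyExpr e)) , wbul (proj₂ (eqv-tyExpr e))
eqv-tyExpr (arrC e f)     = warr (proj₁ (eqv-tyExpr e)) (proj₁ (eqv-tyExpr f)) ,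
                            warr (proj₂ (eqv-tyExpr e)) (proj₂ (eqv-tyExpr f))
eqv-tyExpr (arrTop a)     = warr a tyExpr-⊤ , tyExpr-⊤
eqv-tyExpr (unfold μA)    = μA , tyExpr-unfold μA
eqv-tyExpr (contract μC e) = proj₁ (eqv-tyExpr e) , μC
eqv-tyExpr (dist a b)     = wbul (warr a b) , warr (wbul a) (wbul b)

-- The tail value is invariant under both equivalences

bulletsᵛ-fixpoint : ∀ k w → w ≢ loop → w ≡ bulletsᵛ (suc k) w → w ≡ top
bulletsᵛ-fixpoint k (fin j x) _ eq =
  ⊥-elim (m≢1+n+m j (≡-cong depth (trans eq (bulletsᵛ-fin (suc k) j x))))
  where
    depth : TailVal → ℕ
    depth (fin i _) = i
    depth _         = 0
bulletsᵛ-fixpoint k top  _    _ = refl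
bulletsᵛ-fixpoint k loop w≢lp _ = ⊥-elim (w≢lp refl)

-- Unfolding: B = μA has value μᵛ v where v is the value of the body A.
tailVal-unfold : ∀ B v → tailVal B ≡ μᵛ v → μᵛ v ≡ substᵛ (sub0σ B) v
tailVal-unfold B (fin k (suc x))    _  = sym (bulletsᵛ-var k x)
tailVal-unfold B (fin zero zero)    eq = sym eq
tailVal-unfold B (fin (suc k) zero) eq =
  sym (trans (≡-cong (bulletsᵛ (suc k)) eq) (bulletsᵛ-top (suc k)))
tailVal-unfold B top                _  = refl
tailVal-unfold B loop               _  = refl

-- Contraction: a solution A of A = C[A/X], with C proper in X, has the
-- value of μX.C.
tailVal-contract : ∀ A v → tailVal A ≢ loop → v ≢ fin 0 0 →
                   tailVal A ≡ substᵛ (sub0σ A) v → tailVal A ≡ μᵛ v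
tailVal-contract A (fin k (suc x))    _    _   eq = trans eq (bulletsᵛ-var k x)
tailVal-contract A (fin zero zero)    _    v≢0 _  = ⊥-elim (v≢0 refl)
tailVal-contract A (fin (suc k) zero) A≢lp _   eq = bulletsᵛ-fixpoint k (tailVal A) A≢lp eq
tailVal-contract A top                _    _   eq = eq
tailVal-contract A loop               _    _   eq = eq

eqv-tailVal : ∀ {m A B} → Eqv m A B → tailVal A ≡ tailVal B
eqv-tailVal (refl' _)    = refl
eqv-tailVal (sym' e)     = sym (eqv-tailVal e)
eqv-tailVal (trans' e f) = trans (eqv-tailVal e) (eqv-tailVal f)
eqv-tailVal (bulC e)     = ≡-cong •ᵛ_ (eqv-tailVal e)
eqv-tailVal (arrC _ f)   = eqv-tailVal f
eqv-tailVal (arrTop _)   = refl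
eqv-tailVal {A = μ A} (unfold _) =
  trans (tailVal-unfold (μ A) (tailVal A) refl) (sym (tailVal-subst (sub0σ (μ A)) A))
eqv-tailVal {A = A} (contract {C = C} (wmu p _) e) =
  tailVal-contract A (tailVal C) (tailVal-tyExpr (proj₁ (eqv-tyExpr e))) (tailVal-proper p)
    (trans (eqv-tailVal e) (tailVal-subst (sub0σ A) C))
eqv-tailVal (dist _ _)   = refl

-- (a) ⇒ (b): members of TF are tail finite

tailFinite-var : ∀ x → TailFinite (var x)
tailFinite-var x = [] , 0 , x , [] , refl' wvar

tailFinite-• : ∀ {A} → TailFinite A → TailFinite (• A)
tailFinite-• ([] , n , x , [] , A≅) = [] , suc n , x , [] , bulC A≅
tailFinite-• ((m , B) ∷ ps , n , x , b ∷ bs , A≅) =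
  (suc m , B) ∷ ps , n , x , b ∷ bs , bulC A≅

tailFinite-⇒ : ∀ {A B} → TyExpr B → TailFinite A → TailFinite (B ⇒ A)
tailFinite-⇒ {B = B} b (ps , n , x , bs , A≅) =
  (0 , B) ∷ ps , n , x , b ∷ bs , arrC (refl' b) A≅

tailFinite-≅ : ∀ {A B} → A ≅ B → TailFinite B → TailFinite A
tailFinite-≅ A≅B (ps , n , x , bs , B≅) = ps , n , x , bs , trans' A≅B B≅

-- The general statement, for a substitution sending the variables bound
-- outside TFᵏ's scope (indices ≥ k) to variables; every μ is unfolded.
TFᵏ-tailFinite : ∀ {k A} → TFᵏ k A → ∀ σ → (∀ x → TyExpr (σ x)) →
                 (∀ x → k ≤ x → ∃[ y ] σ x ≡ var y) → TailFinite (subst σ A)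
TFᵏ-tailFinite (tfvar {x = x} k≤x) σ tyσ free with free x k≤x
... | y , σx≡y = transport TailFinite (sym σx≡y) (tailFinite-var y)
TFᵏ-tailFinite (tfbul a) σ tyσ free = tailFinite-• (TFᵏ-tailFinite a σ tyσ free)
TFᵏ-tailFinite (tfarr b a) σ tyσ free =
  tailFinite-⇒ (tyExpr-subst σ tyσ b) (TFᵏ-tailFinite a σ tyσ free)
TFᵏ-tailFinite (tfmu {A = A} μA a) σ tyσ free =
  tailFinite-≅ (unfold (tyExpr-subst σ tyσ μA))
    (transport TailFinite (sym (exts-[/0] (subst σ (μ A)) σ A))
      (TFᵏ-tailFinite a (subst σ (μ A) ∷ₛ σ) (tyExpr-∷ₛ (tyExpr-subst σ tyσ μA) tyσ) free′))
  where
    free′ : ∀ x → suc _ ≤ x → ∃[ y ] (subst σ (μ A) ∷ₛ σ) x ≡ var y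
    free′ (suc x) (s≤s k≤x) = free x k≤x

TF⇒tailFinite : ∀ A → TF A → TailFinite A
TF⇒tailFinite A tf = transport TailFinite (subst-id A)
  (TFᵏ-tailFinite tf var (λ _ → wvar) (λ x _ → x , refl))

-- (b) ⇒ (c): tail finite types are not equivalent to ⊤

tailVal-tfForm : ∀ ps n x → ∃[ j ] tailVal (tfForm ps n x) ≡ fin j x
tailVal-tfForm [] n x = n , trans (tailVal-bullets n (var x)) (bulletsᵛ-var n x)
tailVal-tfForm ((m , B) ∷ ps) n x =
  let (j , eq) = tailVal-tfForm ps n x
  in m + j , trans (tailVal-bullets m (B ⇒ tfForm ps n x))
                   (trans (≡-cong (bulletsᵛ m) eq) (bulletsᵛ-fin m j x))

tailFinite⇒tailVal≢top : ∀ {A} → TailFinite A → tailVal A ≢ top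
tailFinite⇒tailVal≢top (ps , n , x , _ , A≅) A↦top =
  top≢fin (trans (sym A↦top) (trans (eqv-tailVal A≅) (proj₂ (tailVal-tfForm ps n x))))

-- The tail value of ⊤ is `top`.
tailFinite⇒≁⊤ : ∀ m {A} → TailFinite A → ¬ Eqv m A ⊤ᵗ
tailFinite⇒≁⊤ m tf A∼⊤ = tailFinite⇒tailVal≢top tf (eqv-tailVal A∼⊤)

-- (c) ⇒ (d): ⊤-variants are equivalent to ⊤

shape-subst-⊤ : ∀ {m} Γ σ → (∀ x → T (lookupB (guard Γ) x) → Eqv m (σ x) ⊤ᵗ) →
                (∀ x → TyExpr (σ x)) →
                ∀ {C} → TyExpr C → TVShape Γ (tail C) → Eqv m (subst σ C) ⊤ᵗ
shape-subst-⊤ Γ σ bound∼⊤ tyσ (wvar {x}) sh = bound∼⊤ x (lookup-guard Γ x sh)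
shape-subst-⊤ Γ σ bound∼⊤ tyσ (warr b c) sh =
  trans' (arrC (refl' (tyExpr-subst σ tyσ b)) (shape-subst-⊤ Γ σ bound∼⊤ tyσ c sh))
         (arrTop (tyExpr-subst σ tyσ b))
shape-subst-⊤ {m} Γ σ bound∼⊤ tyσ (wbul c) sh =
  trans' (bulC (shape-subst-⊤ (guard Γ) σ guarded∼⊤ tyσ c sh)) (sym' (unfold tyExpr-⊤))
  where
    guarded∼⊤ : ∀ x → T (lookupB (guard (guard Γ)) x) → Eqv m (σ x) ⊤ᵗ
    guarded∼⊤ x = bound∼⊤ x ∘ transport T (lookup-guard-idem Γ x)
shape-subst-⊤ {m} Γ σ bound∼⊤ tyσ {μ C} μC@(wmu _ c) sh =
  sym' (contract (tyExpr-subst σ tyσ μC)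
    (transport (Eqv m ⊤ᵗ) (sym (exts-[/0] ⊤ᵗ σ C))
      (sym' (shape-subst-⊤ (false ∷ Γ) (⊤ᵗ ∷ₛ σ) bound∼⊤′ (tyExpr-∷ₛ tyExpr-⊤ tyσ) c sh))))
  where
    bound∼⊤′ : ∀ x → T (lookupB (guard (false ∷ Γ)) x) → Eqv m ((⊤ᵗ ∷ₛ σ) x) ⊤ᵗ
    bound∼⊤′ zero    _ = refl' tyExpr-⊤
    bound∼⊤′ (suc x) h = bound∼⊤ x h

-- A ⊤-variant is the case Γ = [] and σ = var.
topVariant⇒∼⊤ : ∀ m {A} → TyExpr A → TopVariant A → Eqv m A ⊤ᵗ
topVariant⇒∼⊤ m {A} a tv =
  transport (λ B → Eqv m B ⊤ᵗ) (subst-id A) (shape-subst-⊤ [] var (λ _ ()) (λ _ → wvar) a tv)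

-- (d) ⇒ (a): type expressions that are not ⊤-variants lie in TF

•ᵛ-fin : ∀ v j x → •ᵛ v ≡ fin j x → ∃[ i ] v ≡ fin i x
•ᵛ-fin (fin i y) _ _ refl = i , refl

tailVal⇒TFᵏ : ∀ {A k j x} → TyExpr A → tailVal A ≡ fin j x → k ≤ x → TFᵏ k A
tailVal⇒TFᵏ wvar refl k≤x = tfvar k≤x
tailVal⇒TFᵏ (warr b a) eq k≤x = tfarr b (tailVal⇒TFᵏ a eq k≤x)
tailVal⇒TFᵏ {• A} (wbul a) eq k≤x =
  tfbul (tailVal⇒TFᵏ a (proj₂ (•ᵛ-fin (tailVal A) _ _ eq)) k≤x)
tailVal⇒TFᵏ {μ A} μA@(wmu _ a) eq k≤x =
  tfmu μA (tailVal⇒TFᵏ a (μᵛ-fin (tailVal A) _ _ eq) (s≤s k≤x))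

-- A type expression's tail value is `fin` or `top`; only `fin` is possible
-- for a non-⊤-variant.
¬topVariant⇒TF : ∀ {A} → TyExpr A → ¬ TopVariant A → TF A
¬topVariant⇒TF {A} a ¬tv with tailVal A in eq
... | fin j x = tailVal⇒TFᵏ a eq z≤n
... | top     = ⊥-elim (¬tv (from (topVariant⇔top A) eq))
... | loop    = ⊥-elim (tailVal-tyExpr a eq)

theorem8p11 : (m : Mode) (A : Ty) → TyExpr A →
    (TF A ⇔ TailFinite A) × (TailFinite A ⇔ (¬ Eqv m A ⊤ᵗ)) × ((¬ Eqv m A ⊤ᵗ) ⇔ (¬ TopVariant A))
theorem8p11 m A a =
  mk⇔ a⇒b (d⇒a ∘ c⇒d ∘ b⇒c) , mk⇔ b⇒c (a⇒b ∘ d⇒a ∘ c⇒d) , mk⇔ c⇒d (b⇒c ∘ a⇒b ∘ d⇒a)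
  where
    a⇒b : TF A → TailFinite A
    a⇒b = TF⇒tailFinite A
    b⇒c : TailFinite A → ¬ Eqv m A ⊤ᵗ
    b⇒c = tailFinite⇒≁⊤ m
    c⇒d : ¬ Eqv m A ⊤ᵗ → ¬ TopVariant A
    c⇒d ≁⊤ = ≁⊤ ∘ topVariant⇒∼⊤ m a
    d⇒a : ¬ TopVariant A → TF A
    d⇒a = ¬topVariant⇒TF a
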